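{- Let $n\in\mathbb{N}$. If the equation $x_1^2+2x_2^2+4x_3^2+8x_4^2=n$ has a solution $(x_1,x_2,x_3,x_4)\in\mathbb{Z}^4$ with $x_j\equiv 12\pmod{20}$ for all $j$, then the equation $x_1^2+2x_2^2+4x_3^2+8x_4^2=256n$ also has a solution $(x_1,x_2,x_3,x_4)\in\mathbb{Z}^4$ with $x_j\equiv 12\pmod{20}$ for all $j$. -}

module Defs where

open import Data.Nat as ℕ using (ℕ)
open import Data.Integer using (ℤ; +_; _+_; _*_; _-_)
open import Data.Integer.Divisibility using (_∣_)
open import Data.Product using (Σ-syntax; _×_)
open import Relation.Binary.PropositionalEquality using (_≡_)

Cong12mod20 : ℤ → Set
Cong12mod20 x = (+ 20) ∣ (x - + 12)

Q : ℤ → ℤ → ℤ → ℤ → ℤ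
Q x₁ x₂ x₃ x₄ = x₁ * x₁ + (+ 2) * (x₂ * x₂) + (+ 4) * (x₃ * x₃) + (+ 8) * (x₄ * x₄)

HasSol : ℕ → Set
HasSol m = Σ[ x₁ ∈ ℤ ] Σ[ x₂ ∈ ℤ ] Σ[ x₃ ∈ ℤ ] Σ[ x₄ ∈ ℤ ]
  (Q x₁ x₂ x₃ x₄ ≡ + m) × Cong12mod20 x₁ × Cong12mod20 x₂ × Cong12mod20 x₃ × Cong12mod20 x₄

{-# OPTIONS --safe #-}
-- Q is a quadratic form, so scaling a solution by 16 multiplies its value by 256,
-- and 16 · 12 ≡ 12 (mod 20), so scaling by 16 preserves the residue 12 mod 20.
module Submission where

open import Defs
open import Data.Nat using (ℕ; _*_)
open import Data.Integer as ℤ using (ℤ; +_; _+_; _-_)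
open import Data.Integer.Properties using (pos-*)
open import Data.Integer.Divisibility using (_∣_)
open import Data.Integer.Divisibility.Signed as Signed using (∣ᵤ⇒∣; ∣⇒∣ᵤ; ∣n⇒∣m*n; ∣m∣n⇒∣m+n)
open import Data.Integer.Tactic.RingSolver using (solve-∀)
open import Data.Product using (_,_)
open import Relation.Binary.PropositionalEquality using (_≡_; refl; subst; cong; sym; module ≡-Reasoning)

Q-homogeneous : ∀ k a b c d →
                Q (k ℤ.* a) (k ℤ.* b) (k ℤ.* c) (k ℤ.* d) ≡ (k ℤ.* k) ℤ.* Q a b c d
Q-homogeneous = homogeneous
  where
  -- the ring solver reflects the goal syntactically, so Q must be unfolded by hand
  homogeneous : ∀ k a b c d →
    (k ℤ.* a) ℤ.* (k ℤ.* a) + (+ 2) ℤ.* ((k ℤ.* b) ℤ.* (k ℤ.* b))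
      + (+ 4) ℤ.* ((k ℤ.* c) ℤ.* (k ℤ.* c)) + (+ 8) ℤ.* ((k ℤ.* d) ℤ.* (k ℤ.* d))
    ≡ (k ℤ.* k) ℤ.* (a ℤ.* a + (+ 2) ℤ.* (b ℤ.* b) + (+ 4) ℤ.* (c ℤ.* c) + (+ 8) ℤ.* (d ℤ.* d))
  homogeneous = solve-∀

*-sub-split : ∀ k x r → k ℤ.* x - r ≡ k ℤ.* (x - r) + (k ℤ.* r - r)
*-sub-split = solve-∀

∣-sub-*ˡ : ∀ {m x r} k → m ∣ x - r → m ∣ k ℤ.* r - r → m ∣ k ℤ.* x - r
∣-sub-*ˡ {m} {x} {r} k m∣x-r m∣kr-r =
  ∣⇒∣ᵤ (subst (m Signed.∣_) (sym (*-sub-split k x r))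
              (∣m∣n⇒∣m+n (∣n⇒∣m*n k (∣ᵤ⇒∣ m∣x-r)) (∣ᵤ⇒∣ m∣kr-r)))

Cong12mod20-*16 : ∀ x → Cong12mod20 x → Cong12mod20 ((+ 16) ℤ.* x)
Cong12mod20-*16 x x≡12 =
  ∣-sub-*ˡ {+ 20} {x} {+ 12} (+ 16) x≡12 (∣⇒∣ᵤ {+ 20} (Signed.divides (+ 9) refl))

lemma5p1 : (n : ℕ) → HasSol n → HasSol (256 * n)
lemma5p1 n (a , b , c , d , Qabcd≡n , a≡12 , b≡12 , c≡12 , d≡12) =
  (+ 16) ℤ.* a , (+ 16) ℤ.* b , (+ 16) ℤ.* c , (+ 16) ℤ.* d ,
  Q≡256n ,
  Cong12mod20-*16 a a≡12 , Cong12mod20-*16 b b≡12 ,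
  Cong12mod20-*16 c c≡12 , Cong12mod20-*16 d d≡12
  where
  open ≡-Reasoning
  Q≡256n : Q ((+ 16) ℤ.* a) ((+ 16) ℤ.* b) ((+ 16) ℤ.* c) ((+ 16) ℤ.* d) ≡ + (256 * n)
  Q≡256n = begin
    Q ((+ 16) ℤ.* a) ((+ 16) ℤ.* b) ((+ 16) ℤ.* c) ((+ 16) ℤ.* d) ≡⟨ Q-homogeneous (+ 16) a b c d ⟩
    (+ 256) ℤ.* Q a b c d                                           ≡⟨ cong ((+ 256) ℤ.*_) Qabcd≡n ⟩
    (+ 256) ℤ.* (+ n)                                               ≡⟨ sym (pos-* 256 n) ⟩
    + (256 * n)                                                     ∎
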